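{- Let $\tau$ be a monad, $\omega$ a monoid and $\alpha,\beta$ representable types, all in the sense described in the context. Then $\big(\forall x\in\alpha,\ \forall k:\alpha\to\mathrm{WriterT}(\omega,\tau)\cdot\beta\text{ continuous}.\ \mathrm{bindWT}\,(\mathrm{unitWT}\,x)\,k=k\,x\big)$ holds if and only if $\mathrm{return}_{\mathrm{Writer}\,\omega\cdot\beta}(\bot)=\bot$.
   Context: All types are pointed cpos (pcpos) with least element $\bot$; $\alpha\to\beta$ is the pcpo of continuous functions. Fix a pcpo $\mathcal{U}$. A representable type is a pcpo $\alpha$ with continuous $\mathrm{emb}_\alpha:\alpha\to\mathcal{U}$ and $\mathrm{proj}_\alpha:\mathcal{U}\to\alpha$ such that $\mathrm{proj}_\alpha\circ\mathrm{emb}_\alpha=\mathrm{id}$ and $\mathrm{emb}_\alpha\circ\mathrm{proj}_\alpha\sqsubseteq\mathrm{id}$. $\mathcal{U}$ is representable with identities. If $\alpha,\beta$ are representable, then $\alpha\to\beta$ is representable with $\mathrm{emb}(h)=\mathrm{in}(\mathrm{emb}_\beta\circ h\circ\mathrm{proj}_\alpha)$ and $\mathrm{proj}(u)=\mathrm{proj}_\beta\circ\mathrm{out}(u)\circ\mathrm{emb}_\alpha$, for fixed continuous $\mathrm{in},\mathrm{out}$ with $\mathrm{out}\circ\mathrm{in}=\mathrm{id}$ and $\mathrm{in}\circ\mathrm{out}\sqsubseteq\mathrm{id}$. Define $\mathrm{coerce}_{\alpha,\beta}=\mathrm{proj}_\beta\circ\mathrm{emb}_\alpha$ and $\mathrm{REP}(\alpha)=\mathrm{emb}_\alpha\circ\mathrm{proj}_\alpha$.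 $\mathcal{D}$ is the pcpo of deflations on $\mathcal{U}$ (continuous $d$ with $d\circ d=d\sqsubseteq\mathrm{id}$). A type constructor $\tau$ is a continuous $T_\tau:\mathcal{D}\to\mathcal{D}$. $\tau\cdot\alpha=\{u\in\mathcal{U}\mid T_\tau(\mathrm{REP}(\alpha))(u)=u\}$, with $\mathrm{emb}$ the inclusion and $\mathrm{proj}=T_\tau(\mathrm{REP}(\alpha))$. $\tau$ is a monad if it has continuous maps $\underline{\mathrm{fmap}}:(\mathcal{U}\to\mathcal{U})\to(\tau\cdot\mathcal{U}\to\tau\cdot\mathcal{U})$, $\underline{\mathrm{return}}:\mathcal{U}\to\tau\cdot\mathcal{U}$, $\underline{\mathrm{bind}}:\tau\cdot\mathcal{U}\to(\mathcal{U}\to\tau\cdot\mathcal{U})\to\tau\cdot\mathcal{U}$ satisfying: - $\mathrm{emb}_{\tau\cdot\mathcal{U}}\circ\underline{\mathrm{fmap}}(d)\circ\mathrm{proj}_{\tau\cdot\mathcal{U}}=T_\tau(d)$ for $d\in\mathcal{D}$; - $\underline{\mathrm{fmap}}(f\circ g)=\underline{\mathrm{fmap}}(f)\circ\underline{\mathrm{fmap}}(g)$; - $\underline{\mathrm{return}}(u)\mathbin{\underline{\mathrm{bind}}}k=k(u)$; - $(m\mathbin{\underline{\mathrm{bind}}}h)\mathbin{\underline{\mathrm{bind}}}k=m\mathbin{\underline{\mathrm{bind}}}(\lambda x.\,h(x)\mathbin{\underline{\mathrm{bind}}}k)$; - $\underline{\mathrm{fmap}}(f)(m)=m\mathbin{\underline{\mathrm{bind}}}(\underline{\mathrm{return}}\circ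 f)$. Polymorphic operations: - $\mathrm{return}_\alpha(a)=\mathrm{coerce}_{\tau\cdot\mathcal{U},\tau\cdot\alpha}(\underline{\mathrm{return}}(\mathrm{emb}_\alpha a))$; - for $m\in\tau\cdot\alpha$ and $k:\alpha\to\tau\cdot\beta$, $m\mathbin{>\!\!>\!\!=}k=\mathrm{coerce}_{\tau\cdot\mathcal{U},\tau\cdot\beta}\big(\mathrm{coerce}_{\tau\cdot\alpha,\tau\cdot\mathcal{U}}(m)\mathbin{\underline{\mathrm{bind}}}(\mathrm{coerce}_{\tau\cdot\beta,\tau\cdot\mathcal{U}}\circ k\circ\mathrm{proj}_\alpha)\big)$. A monoid is a representable type $\omega$ with an element $\varnothing\in\omega$ and a continuous $\bullet:\omega\to\omega\to\omega$ such that $\bullet$ is associative and $\varnothing\bullet x=x\bullet\varnothing=x$. $\mathrm{Writer}\,\omega\cdot\alpha$ is a representable type whose elements are $\bot$ and $\mathrm{Result}(w,a)$ for $w\in\omega$, $a\in\alpha$. $\mathrm{Result}$ is a continuous, non-strict (lazy) constructor, i.e. the type is isomorphic to $(\omega_\bot\otimes\alpha_\bot)_\bot$. $\mathrm{WriterT}(\omega,\tau)\cdot\alpha$ is a representable type with mutually inverse continuous bijections $\mathrm{WriterT}:\tau\cdot(\mathrm{Writer}\,\omega\cdot\alpha)\to\mathrm{WriterT}(\omega,\tau)\cdot\alpha$ and $\mathrm{runWT}$. Define: - $\mathrm{unitWT}(a)=\mathrm{WriterT}(\mathrm{return}(\mathrm{Result}(\varnothing,a)))$; - for $k:\alpha\to\mathrm{WriterT}(\omega,\tau)\cdot\beta$,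 $\mathrm{bindWT}\,m\,k=\mathrm{WriterT}\big(\mathrm{runWT}(m)\mathbin{>\!\!>\!\!=}S_k\big)$. Here $S_k$ is strict with $S_k(\mathrm{Result}(w_1,a))=\mathrm{runWT}(k\,a)\mathbin{>\!\!>\!\!=}T_{w_1}$, and $T_{w_1}$ is strict with $T_{w_1}(\mathrm{Result}(w_2,b))=\mathrm{return}(\mathrm{Result}(w_1\bullet w_2,b))$. -}

module Defs where

open import Data.Nat using (ℕ; suc)
open import Data.Product using (Σ; _×_; _,_; proj₁; proj₂; Σ-syntax)
open import Data.Sum using (_⊎_)
open import Relation.Nullary using (¬_)

-- Equality of elements is the induced
-- equivalence  x ≈ y  :=  x ⊑ y × y ⊑ x  (i.e. the cpo is the quotient).

record Pcpo : Set₁ where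
  infix 4 _⊑_
  field
    Car      : Set
    _⊑_      : Car → Car → Set
    ⊑-refl   : ∀ {x} → x ⊑ x
    ⊑-trans  : ∀ {x y z} → x ⊑ y → y ⊑ z → x ⊑ z
    bot      : Car
    bot-least : ∀ {x} → bot ⊑ x
    ⨆        : (c : ℕ → Car) → (∀ n → c n ⊑ c (suc n)) → Car
    ⨆-ub     : ∀ c p n → c n ⊑ ⨆ c p
    ⨆-lub    : ∀ c p {x} → (∀ n → c n ⊑ x) → ⨆ c p ⊑ x

open Pcpo public using (Car; bot)

Leq : (A : Pcpo) → Car A → Car A → Set
Leq A x y = Pcpo._⊑_ A x y

syntax Leq A x y = x ⊑[ A ] y

Eqv : (A : Pcpo) → Car A → Car A → Set
Eqv A x y = Pcpo._⊑_ A x y × Pcpo._⊑_ A y x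

syntax Eqv A x y = x ≈[ A ] y

infix 4 Leq Eqv

⨆-mono : (A : Pcpo) → ∀ c p d q → (∀ n → Pcpo._⊑_ A (c n) (d n))
       → Pcpo._⊑_ A (Pcpo.⨆ A c p) (Pcpo.⨆ A d q)
⨆-mono A c p d q h =
  Pcpo.⨆-lub A c p (λ n → Pcpo.⊑-trans A (h n) (Pcpo.⨆-ub A d q n))

record Cont (A B : Pcpo) : Set where
  field
    fun  : Car A → Car B
    mono : ∀ {x y} → Pcpo._⊑_ A x y → Pcpo._⊑_ B (fun x) (fun y)
    cont : ∀ c p → Pcpo._⊑_ B (fun (Pcpo.⨆ A c p))
                              (Pcpo.⨆ B (λ n → fun (c n)) (λ n → mono (p n)))

open Cont public using (fun; mono)

infixl 9 _·_
_·_ : ∀ {A B} → Cont A B → Car A → Car B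
f · x = Cont.fun f x

idC : (A : Pcpo) → Cont A A
idC A = record { fun = λ x → x ; mono = λ p → p
               ; cont = λ c p → ⨆-mono A c p c p (λ n → Pcpo.⊑-refl A) }

infixr 9 _∘C_
_∘C_ : ∀ {A B C} → Cont B C → Cont A B → Cont A C
_∘C_ {A} {B} {C} g f = record
  { fun = λ x → g · (f · x)
  ; mono = λ p → Cont.mono g (Cont.mono f p)
  ; cont = λ c p → Pcpo.⊑-trans C (Cont.mono g (Cont.cont f c p))
      (Pcpo.⊑-trans C (Cont.cont g _ _)
        (⨆-mono C _ _ _ _ (λ n → Pcpo.⊑-refl C)))
  }

constC : ∀ {A} (B : Pcpo) → Car B → Cont A B
constC B b = record { fun = λ _ → b ; mono = λ _ → Pcpo.⊑-refl B
                    ; cont = λ c p → Pcpo.⨆-ub B (λ _ → b) _ 0 }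

[_⇒_] : Pcpo → Pcpo → Pcpo
[ A ⇒ B ] = record
  { Car = Cont A B
  ; _⊑_ = λ f g → ∀ x → Pcpo._⊑_ B (f · x) (g · x)
  ; ⊑-refl = λ x → Pcpo.⊑-refl B
  ; ⊑-trans = λ p q x → Pcpo.⊑-trans B (p x) (q x)
  ; bot = constC B (Pcpo.bot B)
  ; bot-least = λ x → Pcpo.bot-least B
  ; ⨆ = sup
  ; ⨆-ub = λ c p n x → Pcpo.⨆-ub B (λ m → c m · x) (λ m → p m x) n
  ; ⨆-lub = λ c p h x → Pcpo.⨆-lub B (λ m → c m · x) (λ m → p m x) (λ n → h n x)
  }
  where
  sup : (c : ℕ → Cont A B) → (∀ n (x : Car A) → Pcpo._⊑_ B (c n · x) (c (suc n) · x)) → Cont A B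
  sup c p = record
    { fun = λ x → Pcpo.⨆ B (λ n → c n · x) (λ n → p n x)
    ; mono = λ {x} {y} q → ⨆-mono B _ _ _ _ (λ n → Cont.mono (c n) q)
    ; cont = λ d q → Pcpo.⨆-lub B _ _ (λ n →
        Pcpo.⊑-trans B (Cont.cont (c n) d q)
          (⨆-mono B _ _ _ _ (λ m → Pcpo.⨆-ub B (λ k → c k · d m) (λ k → p k (d m)) n)))
    }

applyC : ∀ {A B C} → Cont A [ B ⇒ C ] → Car B → Cont A C
applyC {A} {B} {C} f b = record
  { fun = λ a → (f · a) · b
  ; mono = λ p → Cont.mono f p b
  ; cont = λ c p → Cont.cont f c p b }

Sub : (P : Pcpo) (Q : Car P → Set) → Q (Pcpo.bot P)
    → (∀ c p → (∀ n → Q (c n)) → Q (Pcpo.⨆ P c p)) → Pcpo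
Sub P Q qb qs = record
  { Car = Σ (Car P) Q
  ; _⊑_ = λ x y → Pcpo._⊑_ P (proj₁ x) (proj₁ y)
  ; ⊑-refl = Pcpo.⊑-refl P
  ; ⊑-trans = Pcpo.⊑-trans P
  ; bot = Pcpo.bot P , qb
  ; bot-least = Pcpo.bot-least P
  ; ⨆ = λ c p → Pcpo.⨆ P (λ n → proj₁ (c n)) p , qs _ p (λ n → proj₂ (c n))
  ; ⨆-ub = λ c p n → Pcpo.⨆-ub P (λ n → proj₁ (c n)) p n
  ; ⨆-lub = λ c p h → Pcpo.⨆-lub P (λ n → proj₁ (c n)) p h
  }

IsDefl : (U : Pcpo) → Cont U U → Set
IsDefl U d = (∀ u → d · (d · u) ≈[ U ] d · u) × (∀ u → d · u ⊑[ U ] u)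

D : Pcpo → Pcpo
D U = Sub [ U ⇒ U ] (IsDefl U)
  ((λ u → Pcpo.⊑-refl U , Pcpo.⊑-refl U) , (λ u → Pcpo.bot-least U))
  closed
  where
  open Pcpo U using (_⊑_; ⊑-trans; ⨆-lub; ⨆-ub)
  closed : ∀ c p → (∀ n → IsDefl U (c n)) → IsDefl U (Pcpo.⨆ [ U ⇒ U ] c p)
  closed c p h = idem , below
    where
    g = Pcpo.⨆ [ U ⇒ U ] c p
    below : ∀ (u : Pcpo.Car U) → g · u ⊑ u
    below u = ⨆-lub _ _ (λ n → proj₂ (h n) u)
    idem : ∀ (u : Pcpo.Car U) → (g · (g · u) ⊑ g · u) × (g · u ⊑ g · (g · u))
    idem u =
      ⨆-lub _ _ (λ n → ⊑-trans (Cont.cont (c n) _ _)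
        (⨆-lub _ _ (λ m → ⊑-trans (proj₂ (h n) (c m · u)) (⨆-ub (λ k → c k · u) (λ k → p k u) m))))
      , ⨆-lub _ _ (λ n → ⊑-trans (proj₂ (proj₁ (h n) u))
          (⊑-trans (Cont.mono (c n) (⨆-ub (λ k → c k · u) (λ k → p k u) n))
            (⨆-ub (λ k → c k · (g · u)) (λ k → p k (g · u)) n)))

defl : ∀ {U} → Car (D U) → Cont U U
defl = proj₁

record Rep (U A : Pcpo) : Set where
  field
    emb      : Cont A U
    proj     : Cont U A
    proj-emb : ∀ a → proj · (emb · a) ≈[ A ] a
    emb-proj : ∀ u → emb · (proj · u) ⊑[ U ] u

idRep : (U : Pcpo) → Rep U U
idRep U = record { emb = idC U ; proj = idC U
                 ; proj-emb = λ a → Pcpo.⊑-refl U , Pcpo.⊑-refl U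
                 ; emb-proj = λ u → Pcpo.⊑-refl U }

coerce : ∀ {U A B} → Rep U A → Rep U B → Cont A B
coerce rA rB = Rep.proj rB ∘C Rep.emb rA

REP : ∀ {U A} → Rep U A → Car (D U)
REP {U} {A} r = (emb ∘C proj) ,
  (λ u → Cont.mono emb (proj₁ (proj-emb (proj · u))) ,
         Cont.mono emb (proj₂ (proj-emb (proj · u))))
  , emb-proj
  where open Rep r

TypeCon : Pcpo → Set
TypeCon U = Cont (D U) (D U)

Fix : ∀ {U} → Car (D U) → Pcpo
Fix {U} d = Sub U (λ u → defl d · u ≈[ U ] u)
  (proj₂ (proj₂ d) (Pcpo.bot U) , Pcpo.bot-least U)
  (λ c p h →
     Pcpo.⊑-trans U (Cont.cont (defl d) c p)
       (⨆-mono U _ _ _ _ (λ n → proj₁ (h n)))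
   , Pcpo.⨆-lub U _ _ (λ n → Pcpo.⊑-trans U (proj₂ (h n))
       (Cont.mono (defl d) (Pcpo.⨆-ub U c p n))))

_·T_ : ∀ {U A} → TypeCon U → Rep U A → Pcpo
τ ·T r = Fix (τ · REP r)

infixl 8 _·T_

repT : ∀ {U A} (τ : TypeCon U) (r : Rep U A) → Rep U (τ ·T r)
repT {U} τ r = record
  { emb = record { fun = proj₁ ; mono = λ q → q
                 ; cont = λ c p → Pcpo.⊑-refl U }
  ; proj = record
      { fun = λ u → d · u , proj₁ (proj₂ (τ · REP r)) u
      ; mono = Cont.mono d
      ; cont = λ c p → Pcpo.⊑-trans U (Cont.cont d c p)
                         (⨆-mono U _ _ _ _ (λ n → Pcpo.⊑-refl U)) }
  ; proj-emb = λ a → proj₂ a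
  ; emb-proj = λ u → proj₂ (proj₂ (τ · REP r)) u
  }
  where d = defl (τ · REP r)

TU : ∀ {U} → TypeCon U → Pcpo
TU {U} τ = τ ·T idRep U

record Monad (U : Pcpo) (τ : TypeCon U) : Set where
  field
    fmap : Cont [ U ⇒ U ] [ TU τ ⇒ TU τ ]
    ret  : Cont U (TU τ)
    bind : Cont (TU τ) [ [ U ⇒ TU τ ] ⇒ TU τ ]
    fmap-T : ∀ (d : Car (D U)) (u : Car U) →
      Rep.emb (repT τ (idRep U)) · (fmap · defl d · (Rep.proj (repT τ (idRep U)) · u))
        ≈[ U ] defl (τ · d) · u
    fmap-∘ : ∀ (f g : Cont U U) (m : Car (TU τ)) →
      fmap · (f ∘C g) · m ≈[ TU τ ] fmap · f · (fmap · g · m)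
    ret-bind : ∀ (u : Car U) (k : Cont U (TU τ)) →
      bind · (ret · u) · k ≈[ TU τ ] k · u
    bind-assoc : ∀ (m : Car (TU τ)) (h k : Cont U (TU τ)) →
      bind · (bind · m · h) · k ≈[ TU τ ] bind · m · (applyC bind k ∘C h)
    fmap-bind : ∀ (f : Cont U U) (m : Car (TU τ)) →
      fmap · f · m ≈[ TU τ ] bind · m · (ret ∘C f)

module Poly {U : Pcpo} {τ : TypeCon U} (M : Monad U τ) where
  open Monad M

  returnP : ∀ {A} (rA : Rep U A) → Car A → Car (τ ·T rA)
  returnP rA a = coerce (repT τ (idRep U)) (repT τ rA) · (ret · (Rep.emb rA · a))

  bindP : ∀ {A B} (rA : Rep U A) (rB : Rep U B) →
          Car (τ ·T rA) → Cont A (τ ·T rB) → Car (τ ·T rB)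
  bindP rA rB m k =
    coerce (repT τ (idRep U)) (repT τ rB) ·
      (bind · (coerce (repT τ rA) (repT τ (idRep U)) · m)
            · (coerce (repT τ rB) (repT τ (idRep U)) ∘C k ∘C Rep.proj rA))

record MonoidOn (U ω : Pcpo) : Set where
  field
    rep   : Rep U ω
    ε     : Car ω
    _•_   : Cont ω [ ω ⇒ ω ]
    assoc : ∀ x y z → _•_ · (_•_ · x · y) · z ≈[ ω ] _•_ · x · (_•_ · y · z)
    identityˡ : ∀ x → _•_ · ε · x ≈[ ω ] x
    identityʳ : ∀ x → _•_ · x · ε ≈[ ω ] x

-- Writer ω·α : representable type whose elements are bot and
-- Result(w,a) (lazy constructor), i.e. (ω × α)⊥.

record Writer (U ω A : Pcpo) : Set₁ where
  field
    W       : Pcpo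
    rep     : Rep U W
    Result  : Cont ω [ A ⇒ W ]
    cases   : ∀ (x : Car W) → (x ≈[ W ] Pcpo.bot W)
                ⊎ (Σ[ w ∈ Car ω ] Σ[ a ∈ Car A ] x ≈[ W ] Result · w · a)
    Result≢bot : ∀ w a → ¬ (Result · w · a ⊑[ W ] Pcpo.bot W)
    Result-⊑ : ∀ w a w' a' → Result · w · a ⊑[ W ] Result · w' · a'
                 → (w ⊑[ ω ] w') × (a ⊑[ A ] a')

record WriterT (U : Pcpo) (τ : TypeCon U) {ω A : Pcpo} (Wr : Writer U ω A) : Set₁ where
  field
    WT     : Pcpo
    rep    : Rep U WT
    wrap   : Cont (τ ·T Writer.rep Wr) WT
    runWT  : Cont WT (τ ·T Writer.rep Wr)
    run-wrap : ∀ m → runWT · (wrap · m) ≈[ τ ·T Writer.rep Wr ] m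
    wrap-run : ∀ x → wrap · (runWT · x) ≈[ WT ] x

module WriterTOps {U : Pcpo} {τ : TypeCon U} (M : Monad U τ)
                  {ω A B : Pcpo} (Mo : MonoidOn U ω)
                  (WA : Writer U ω A) (WB : Writer U ω B)
                  (TA : WriterT U τ WA) (TB : WriterT U τ WB) where
  open Poly M
  open MonoidOn Mo
  private
    module WA = Writer WA
    module WB = Writer WB
    module TA = WriterT TA
    module TB = WriterT TB

  unitWT : Car A → Car TA.WT
  unitWT a = TA.wrap · returnP WA.rep (WA.Result · ε · a)

  IsTfam : ((w₁ : Car ω) → Cont WB.W (τ ·T WB.rep)) → Set
  IsTfam Tf = ∀ w₁ →
      (Tf w₁ · Pcpo.bot WB.W ≈[ τ ·T WB.rep ] Pcpo.bot (τ ·T WB.rep))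
    × (∀ w₂ b → Tf w₁ · (WB.Result · w₂ · b)
                  ≈[ τ ·T WB.rep ] returnP WB.rep (WB.Result · (_•_ · w₁ · w₂) · b))

  IsSfam : ((w₁ : Car ω) → Cont WB.W (τ ·T WB.rep))
         → ((k : Cont A TB.WT) → Cont WA.W (τ ·T WB.rep)) → Set
  IsSfam Tf Sf = ∀ k →
      (Sf k · Pcpo.bot WA.W ≈[ τ ·T WB.rep ] Pcpo.bot (τ ·T WB.rep))
    × (∀ w₁ a → Sf k · (WA.Result · w₁ · a)
                  ≈[ τ ·T WB.rep ] bindP WB.rep WB.rep (TB.runWT · (k · a)) (Tf w₁))

  bindWT : ((k : Cont A TB.WT) → Cont WA.W (τ ·T WB.rep))
         → Car TA.WT → Cont A TB.WT → Car TB.WT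
  bindWT Sf m k = TB.wrap · bindP WA.rep WB.rep (TA.runWT · m) (Sf k)

module Submission where

-- For WriterT,
-- unfolding unitWT and the left unit law reduce  bindWT (unitWT x) k  to
-- runWT (k x) >>= T_ε.  Hence the WriterT left unit law is equivalent to
-- the right unit law  m >>= T_ε = m  for every m.  Since T_ε is strict and
-- sends Result(w,b) to return(Result(w,b)), it agrees with return exactly
-- when return ⊥ = ⊥: if it does, the right unit law applies; conversely
-- return ⊥ = return ⊥ >>= T_ε = T_ε ⊥ = ⊥.

open import Level using (0ℓ)
open import Data.Product using (_,_; proj₁; proj₂; swap)
open import Data.Sum using (inj₁; inj₂)
open import Function.Bundles using (_⇔_; mk⇔)
open import Function.Properties.Equivalence using () renaming (trans to ⇔-trans)
open import Relation.Binary.Bundles using (Setoid)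
import Relation.Binary.Reasoning.Setoid as SetoidReasoning
open import Defs

≈-setoid : Pcpo → Setoid 0ℓ 0ℓ
≈-setoid P = record
  { Carrier = Car P
  ; _≈_ = Eqv P
  ; isEquivalence = record
      { refl = Pcpo.⊑-refl P , Pcpo.⊑-refl P
      ; sym = swap
      ; trans = λ p q → Pcpo.⊑-trans P (proj₁ p) (proj₁ q)
                      , Pcpo.⊑-trans P (proj₂ q) (proj₂ p)
      }
  }

module ≈-Reasoning (P : Pcpo) = SetoidReasoning (≈-setoid P)

≈-sym : (P : Pcpo) {x y : Car P} → x ≈[ P ] y → y ≈[ P ] x
≈-sym P = Setoid.sym (≈-setoid P)

≈-trans : (P : Pcpo) {x y z : Car P} → x ≈[ P ] y → y ≈[ P ] z → x ≈[ P ] z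
≈-trans P = Setoid.trans (≈-setoid P)

cong≈ : ∀ {A B} (f : Cont A B) {x y : Car A} → x ≈[ A ] y → f · x ≈[ B ] f · y
cong≈ f (x⊑y , y⊑x) = Cont.mono f x⊑y , Cont.mono f y⊑x

pointwise : ∀ {A B} {f g : Cont A B} →
            (∀ x → f · x ≈[ B ] g · x) → f ≈[ [ A ⇒ B ] ] g
pointwise f≈g = (λ x → proj₁ (f≈g x)) , (λ x → proj₂ (f≈g x))

module PolymorphicMonadLaws {U : Pcpo} {τ : TypeCon U} (M : Monad U τ) where
  open Monad M
  open Poly M

  repTU : Rep U (TU τ)
  repTU = repT τ (idRep U)

  -- Every element of τ·α is fixed by T_τ(REP U) = T_τ(id), since REP α ⊑ id
  -- and T_τ is monotone: the coercion τ·α → τ·U is the inclusion.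
  coerce-into-TU : ∀ {A} (r : Rep U A) (m : Car (τ ·T r)) →
                   proj₁ (coerce (repT τ r) repTU · m) ≈[ U ] proj₁ m
  coerce-into-TU r m =
      proj₂ (proj₂ (τ · REP (idRep U))) (proj₁ m)
    , Pcpo.⊑-trans U (proj₂ (proj₂ m))
        (Cont.mono τ {REP r} {REP (idRep U)} (Rep.emb-proj r) (proj₁ m))

  coerce-onto : ∀ {B} (r : Rep U B) (x : Car (TU τ)) (m : Car (τ ·T r)) →
                proj₁ x ≈[ U ] proj₁ m → coerce repTU (repT τ r) · x ≈[ τ ·T r ] m
  coerce-onto r x m x≈m = ≈-trans U (cong≈ (defl (τ · REP r)) x≈m) (proj₂ m)

  fmap-deflation : (d : Car (D U)) (m : Car (TU τ)) →
                   proj₁ (fmap · defl d · m) ≈[ U ] defl (τ · d) · proj₁ m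
  fmap-deflation d m = ≈-trans U
    (cong≈ (fmap · defl d) {m} {Rep.proj repTU · proj₁ m}
           (≈-sym U (coerce-into-TU (idRep U) m)))
    (fmap-T d (proj₁ m))

  returnP-underlying : ∀ {A} (r : Rep U A) (a : Car A) →
                       proj₁ (returnP r a) ≈[ U ] proj₁ (ret · (Rep.emb r · a))
  returnP-underlying r a = begin
    defl (τ · REP r) · proj₁ (ret · u)        ≈⟨ fmap-deflation (REP r) (ret · u) ⟨
    proj₁ (fmap · defl (REP r) · (ret · u))    ≈⟨ fmap-bind (defl (REP r)) (ret · u) ⟩
    proj₁ (bind · (ret · u) · (ret ∘C defl (REP r)))
                                               ≈⟨ ret-bind u (ret ∘C defl (REP r)) ⟩
    proj₁ (ret · (Rep.emb r · (Rep.proj r · u)))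
                                               ≈⟨ cong≈ ret (cong≈ (Rep.emb r) (Rep.proj-emb r a)) ⟩
    proj₁ (ret · u)                            ∎
    where
    open ≈-Reasoning U
    u = Rep.emb r · a

  returnP-cong : ∀ {A} (r : Rep U A) {a a' : Car A} →
                 a ≈[ A ] a' → returnP r a ≈[ τ ·T r ] returnP r a'
  returnP-cong r = cong≈ (coerce repTU (repT τ r) ∘C ret ∘C Rep.emb r)

  bindP-cong : ∀ {A B} (rA : Rep U A) (rB : Rep U B) (k : Cont A (τ ·T rB))
               {m m' : Car (τ ·T rA)} →
               m ≈[ τ ·T rA ] m' → bindP rA rB m k ≈[ τ ·T rB ] bindP rA rB m' k
  bindP-cong rA rB k {m} {m'} = cong≈ (coerce repTU (repT τ rB)
    ∘C applyC bind (coerce (repT τ rB) repTU ∘C k ∘C Rep.proj rA)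
    ∘C coerce (repT τ rA) repTU) {m} {m'}

  bindP-returnPˡ : ∀ {A B} (rA : Rep U A) (rB : Rep U B) (a : Car A)
                   (k : Cont A (τ ·T rB)) →
                   bindP rA rB (returnP rA a) k ≈[ τ ·T rB ] k · a
  bindP-returnPˡ rA rB a k = coerce-onto rB (bind · m · K) (k · a) (begin
    proj₁ (bind · m · K)                  ≈⟨ cong≈ (applyC bind K) {m} {ret · u}
                                               (≈-trans U (coerce-into-TU rA (returnP rA a))
                                                          (returnP-underlying rA a)) ⟩
    proj₁ (bind · (ret · u) · K)          ≈⟨ ret-bind u K ⟩
    proj₁ (K · u)                         ≈⟨ cong≈ (coerce (repT τ rB) repTU ∘C k)
                                                   (Rep.proj-emb rA a) ⟩
    proj₁ (coerce (repT τ rB) repTU · (k · a))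
                                          ≈⟨ coerce-into-TU rB (k · a) ⟩
    proj₁ (k · a)                         ∎)
    where
    open ≈-Reasoning U
    u = Rep.emb rA · a
    m = coerce (repT τ rA) repTU · returnP rA a
    K = coerce (repT τ rB) repTU ∘C k ∘C Rep.proj rA

  bindP-returnPʳ : ∀ {B} (r : Rep U B) (m : Car (τ ·T r)) (g : Cont B (τ ·T r)) →
                   (∀ b → g · b ≈[ τ ·T r ] returnP r b) → bindP r r m g ≈[ τ ·T r ] m
  bindP-returnPʳ r m g g≈return = coerce-onto r (bind · m' · K) m (begin
    proj₁ (bind · m' · K)                 ≈⟨ cong≈ (bind · m')
                                                   (pointwise {f = K} {g = ret ∘C f} K≈ret) ⟩
    proj₁ (bind · m' · (ret ∘C f))        ≈⟨ fmap-bind f m' ⟨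
    proj₁ (fmap · f · m')                 ≈⟨ fmap-deflation (REP r) m' ⟩
    defl (τ · REP r) · proj₁ m'           ≈⟨ cong≈ (defl (τ · REP r)) (coerce-into-TU r m) ⟩
    defl (τ · REP r) · proj₁ m            ≈⟨ proj₂ m ⟩
    proj₁ m                               ∎)
    where
    open ≈-Reasoning U
    f = defl (REP r)
    m' = coerce (repT τ r) repTU · m
    K = coerce (repT τ r) repTU ∘C g ∘C Rep.proj r
    K≈ret : ∀ u → K · u ≈[ TU τ ] ret · (f · u)
    K≈ret u = begin
      proj₁ (K · u)                       ≈⟨ cong≈ (coerce (repT τ r) repTU)
                                                   {g · b} {returnP r b} (g≈return b) ⟩
      proj₁ (coerce (repT τ r) repTU · returnP r b)
                                          ≈⟨ coerce-into-TU r (returnP r b) ⟩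
      proj₁ (returnP r b)                 ≈⟨ returnP-underlying r b ⟩
      proj₁ (ret · (f · u))               ∎
      where b = Rep.proj r · u

module WriterTUnitLaw {U : Pcpo} {τ : TypeCon U} (M : Monad U τ)
    {ω A B : Pcpo} (Mo : MonoidOn U ω)
    (WA : Writer U ω A) (WB : Writer U ω B)
    (TA : WriterT U τ WA) (TB : WriterT U τ WB)
    (Tf : (w₁ : Car ω) → Cont (Writer.W WB) (τ ·T Writer.rep WB))
    (Sf : (k : Cont A (WriterT.WT TB)) → Cont (Writer.W WA) (τ ·T Writer.rep WB))
    (isT : WriterTOps.IsTfam M Mo WA WB TA TB Tf)
    (isS : WriterTOps.IsSfam M Mo WA WB TA TB Tf Sf) where
  open Poly M
  open PolymorphicMonadLaws M
  open MonoidOn Mo using (ε; _•_; identityˡ)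
  open WriterTOps M Mo WA WB TA TB using (unitWT; bindWT)
  private
    module WA = Writer WA
    module WB = Writer WB
    module TA = WriterT TA
    module TB = WriterT TB

  τWB : Pcpo
  τWB = τ ·T WB.rep

  bindTε : Car τWB → Car τWB
  bindTε m = bindP WB.rep WB.rep m (Tf ε)

  runWT-bindWT-unitWT : ∀ x k →
    TB.runWT · bindWT Sf (unitWT x) k ≈[ τWB ] bindTε (TB.runWT · (k · x))
  runWT-bindWT-unitWT x k = begin
    TB.runWT · bindWT Sf (unitWT x) k     ≈⟨ TB.run-wrap _ ⟩
    bindP WA.rep WB.rep (TA.runWT · unitWT x) (Sf k)
                                          ≈⟨ bindP-cong WA.rep WB.rep (Sf k)
                                               {TA.runWT · unitWT x} {returnP WA.rep result}
                                               (TA.run-wrap _) ⟩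
    bindP WA.rep WB.rep (returnP WA.rep result) (Sf k)
                                          ≈⟨ bindP-returnPˡ WA.rep WB.rep result (Sf k) ⟩
    Sf k · result                         ≈⟨ proj₂ (isS k) ε x ⟩
    bindTε (TB.runWT · (k · x))           ∎
    where
    open ≈-Reasoning τWB
    result = WA.Result · ε · x

  left-unit⇔Tε-right-unit :
    (∀ x k → bindWT Sf (unitWT x) k ≈[ TB.WT ] k · x) ⇔ (∀ m → bindTε m ≈[ τWB ] m)
  left-unit⇔Tε-right-unit = mk⇔ to from
    where
    -- instantiate the left unit law with ⊥ and the constant map to WriterT m
    to : (∀ x k → bindWT Sf (unitWT x) k ≈[ TB.WT ] k · x) → ∀ m → bindTε m ≈[ τWB ] m
    to left-unit m = begin
      bindTε m                            ≈⟨ bindP-cong WB.rep WB.rep (Tf ε)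
                                            {TB.runWT · (k · x)} {m} (TB.run-wrap m) ⟨
      bindTε (TB.runWT · (k · x))         ≈⟨ runWT-bindWT-unitWT x k ⟨
      TB.runWT · bindWT Sf (unitWT x) k   ≈⟨ cong≈ TB.runWT (left-unit x k) ⟩
      TB.runWT · (TB.wrap · m)            ≈⟨ TB.run-wrap m ⟩
      m                                   ∎
      where
      open ≈-Reasoning τWB
      x = Pcpo.bot A
      k = constC TB.WT (TB.wrap · m)

    from : (∀ m → bindTε m ≈[ τWB ] m) → ∀ x k → bindWT Sf (unitWT x) k ≈[ TB.WT ] k · x
    from right-unit x k = begin
      bindWT Sf (unitWT x) k              ≈⟨ TB.wrap-run _ ⟨
      TB.wrap · (TB.runWT · bindWT Sf (unitWT x) k)
                                          ≈⟨ cong≈ TB.wrap (runWT-bindWT-unitWT x k) ⟩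
      TB.wrap · bindTε (TB.runWT · (k · x))
                                          ≈⟨ cong≈ TB.wrap (right-unit (TB.runWT · (k · x))) ⟩
      TB.wrap · (TB.runWT · (k · x))      ≈⟨ TB.wrap-run (k · x) ⟩
      k · x                               ∎
      where open ≈-Reasoning TB.WT

  -- If return ⊥ = ⊥, then T_ε coincides with return: both are ⊥ on ⊥,
  -- and T_ε (Result(w,b)) = return (Result(ε • w, b)) = return (Result(w,b)).
  Tε≈returnP : returnP WB.rep (Pcpo.bot WB.W) ≈[ τWB ] Pcpo.bot τWB →
               ∀ b → Tf ε · b ≈[ τWB ] returnP WB.rep b
  Tε≈returnP return-strict b with WB.cases b
  ... | inj₁ b≈⊥ = begin
    Tf ε · b                              ≈⟨ cong≈ (Tf ε) b≈⊥ ⟩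
    Tf ε · Pcpo.bot WB.W                  ≈⟨ proj₁ (isT ε) ⟩
    Pcpo.bot τWB                          ≈⟨ return-strict ⟨
    returnP WB.rep (Pcpo.bot WB.W)        ≈⟨ returnP-cong WB.rep b≈⊥ ⟨
    returnP WB.rep b                      ∎
    where open ≈-Reasoning τWB
  ... | inj₂ (w , c , b≈Result) = begin
    Tf ε · b                              ≈⟨ cong≈ (Tf ε) b≈Result ⟩
    Tf ε · (WB.Result · w · c)            ≈⟨ proj₂ (isT ε) w c ⟩
    returnP WB.rep (WB.Result · (_•_ · ε · w) · c)
                                          ≈⟨ returnP-cong WB.rep
                                               (cong≈ (applyC WB.Result c) (identityˡ w)) ⟩
    returnP WB.rep (WB.Result · w · c)    ≈⟨ returnP-cong WB.rep b≈Result ⟨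
    returnP WB.rep b                      ∎
    where open ≈-Reasoning τWB

  Tε-right-unit⇔return-strict :
    (∀ m → bindTε m ≈[ τWB ] m)
      ⇔ (returnP WB.rep (Pcpo.bot WB.W) ≈[ τWB ] Pcpo.bot τWB)
  Tε-right-unit⇔return-strict = mk⇔ to from
    where
    to : (∀ m → bindTε m ≈[ τWB ] m) →
         returnP WB.rep (Pcpo.bot WB.W) ≈[ τWB ] Pcpo.bot τWB
    to right-unit = begin
      returnP WB.rep ⊥W                   ≈⟨ right-unit (returnP WB.rep ⊥W) ⟨
      bindTε (returnP WB.rep ⊥W)          ≈⟨ bindP-returnPˡ WB.rep WB.rep ⊥W (Tf ε) ⟩
      Tf ε · ⊥W                           ≈⟨ proj₁ (isT ε) ⟩
      Pcpo.bot τWB                        ∎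
      where
      open ≈-Reasoning τWB
      ⊥W = Pcpo.bot WB.W

    from : returnP WB.rep (Pcpo.bot WB.W) ≈[ τWB ] Pcpo.bot τWB →
           ∀ m → bindTε m ≈[ τWB ] m
    from return-strict m = bindP-returnPʳ WB.rep m (Tf ε) (Tε≈returnP return-strict)

theorem8 : (U : Pcpo) (τ : TypeCon U) (M : Monad U τ)
    (ω : Pcpo) (Mo : MonoidOn U ω)
    (A B : Pcpo) (rA : Rep U A) (rB : Rep U B)
    (WA : Writer U ω A) (WB : Writer U ω B)
    (TA : WriterT U τ WA) (TB : WriterT U τ WB)
    (Tf : (w₁ : Car ω) → Cont (Writer.W WB) (τ ·T Writer.rep WB))
    (Sf : (k : Cont A (WriterT.WT TB)) → Cont (Writer.W WA) (τ ·T Writer.rep WB)) →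
    WriterTOps.IsTfam M Mo WA WB TA TB Tf →
    WriterTOps.IsSfam M Mo WA WB TA TB Tf Sf →
    ((∀ (x : Car A) (k : Cont A (WriterT.WT TB)) →
        WriterTOps.bindWT M Mo WA WB TA TB Sf (WriterTOps.unitWT M Mo WA WB TA TB x) k
          ≈[ WriterT.WT TB ] k · x)
     ⇔ (Poly.returnP M (Writer.rep WB) (Pcpo.bot (Writer.W WB))
          ≈[ τ ·T Writer.rep WB ] Pcpo.bot (τ ·T Writer.rep WB)))
theorem8 U τ M ω Mo A B rA rB WA WB TA TB Tf Sf isT isS =
  ⇔-trans left-unit⇔Tε-right-unit Tε-right-unit⇔return-strict
  where open WriterTUnitLaw M Mo WA WB TA TB Tf Sf isT isS
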